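{- Let $n\ge1$, $\pi\in S_{n+1}$, and let $P_\pi$ be the polytope of steps for $\pi$. Let $\mathcal{A}$ be an alcove of the affine type $A_n$ arrangement expressed in step coordinates. Then either $\mathcal{A}\subseteq P_\pi$ or $\mathcal{A}\cap P_\pi=\emptyset$.
   Context: With $m_i=\min\{\pi(i),\pi(i+1)\}$ and $M_i=\max\{\pi(i),\pi(i+1)\}$, $P_\pi\subseteq\mathbb{R}^n$ is the set of $(x_1,\dots,x_n)$ with $x_i\ge0$ and $0\le x_{m_i}+\cdots+x_{M_i-1}\le1$ for all $i\in[n]$. In step coordinates, the affine type $A_n$ arrangement consists of the hyperplanes $\{x\in\mathbb{R}^n: x_i+\cdots+x_{j-1}=a\}$ for $1\le i<j\le n+1$ and $a\in\mathbb{Z}$, and its alcoves are the connected components of the complement of their union; each alcove is of the form $\{x: k(i,j)<x_i+\cdots+x_{j-1}<k(i,j)+1\ \text{for all }1\le i<j\le n+1\}$ for an integer-valued function $k$ (its address).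
   Formalization: The alcove $\mathcal{A}$ and the polytope $P_\pi$ are taken as sets of points in ℚ^n instead of $\mathbb{R}^n$. -}

module Defs where

open import Data.Nat as ℕ using (ℕ)
open import Data.Integer as ℤ using (ℤ)
open import Data.Fin using (Fin; toℕ; inject₁; suc; _<_)
open import Data.Fin.Permutation using (Permutation′; _⟨$⟩ʳ_)
open import Data.List using (List; []; _∷_)
open import Data.List using (allFin)
open import Data.Rational using (ℚ; 0ℚ; _+_; _/_; _≤_) renaming (_<_ to _<ℚ_)
open import Data.Product using (_×_)
open import Relation.Nullary using (yes; no)
open import Data.Nat using (_≤?_; _<?_)

-- Points of step space: x = (x_1,…,x_n), 0-indexed as x : Fin n → ℚ.
Point : ℕ → Set
Point n = Fin n → ℚ

segList : ∀ {n} → Point n → ℕ → ℕ → List (Fin n) → ℚ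
segList x a b [] = 0ℚ
segList x a b (t ∷ ts) with a ≤? toℕ t | toℕ t <? b
... | yes _ | yes _ = x t + segList x a b ts
... | _     | _     = segList x a b ts

seg : ∀ {n} → Point n → ℕ → ℕ → ℚ
seg {n} x a b = segList x a b (allFin n)

-- Points of [n+1] are Fin (suc n) (0-indexed); the step-coordinate
-- sum x_a + ⋯ + x_{b-1} for a < b in [n+1] is seg x (toℕ a) (toℕ b).
mi Mi : ∀ {n} → Permutation′ (ℕ.suc n) → Fin n → ℕ
mi π i = ℕ._⊓_ (toℕ (π ⟨$⟩ʳ inject₁ i)) (toℕ (π ⟨$⟩ʳ suc i))
Mi π i = ℕ._⊔_ (toℕ (π ⟨$⟩ʳ inject₁ i)) (toℕ (π ⟨$⟩ʳ suc i))

inP : ∀ {n} → Permutation′ (ℕ.suc n) → Point n → Set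
inP {n} π x =
  (∀ (t : Fin n) → 0ℚ ≤ x t) ×
  (∀ (i : Fin n) → (0ℚ ≤ seg x (mi π i) (Mi π i)) × (seg x (mi π i) (Mi π i) ≤ 1ℚ'))
  where 1ℚ' = ℤ.+ 1 / 1

ℤtoℚ : ℤ → ℚ
ℤtoℚ z = z / 1

inAlcove : ∀ {n} → (Fin (ℕ.suc n) → Fin (ℕ.suc n) → ℤ) → Point n → Set
inAlcove {n} k x = ∀ (a b : Fin (ℕ.suc n)) → a < b →
  (ℤtoℚ (k a b) <ℚ seg x (toℕ a) (toℕ b)) × (seg x (toℕ a) (toℕ b) <ℚ ℤtoℚ (k a b ℤ.+ ℤ.+ 1))

-- Every defining inequality of P_π bounds a partial sum x_a + ⋯ + x_{b-1} (a single
-- step x_t being the case b = a + 1) by an integer, and on an alcove each such sum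
-- ranges over an open interval between consecutive integers. An integer is never
-- inside such an interval, so each inequality holds on the whole alcove or nowhere
-- on it, and so does their conjunction.
module Submission where

open import Defs
open import Data.Nat as ℕ using (ℕ; zero; suc; _≤_)
import Data.Nat.Properties as ℕP
open import Data.Integer as ℤ using (ℤ; +_)
import Data.Integer.Properties as ℤP
open import Data.Integer.GCD using (gcd; gcd-zeroʳ)
open import Data.Fin as Fin using (Fin; toℕ; inject₁)
import Data.Fin.Properties as FinP
open import Data.Fin.Permutation using (Permutation′; _⟨$⟩ʳ_; _⟨$⟩ˡ_; inverseˡ)
open import Data.List using (List; []; _∷_; tabulate)
open import Data.List.Relation.Unary.All using (All; []; _∷_)
open import Data.List.Relation.Unary.All.Properties using (tabulate⁺)
open import Data.Rational as ℚ using (ℚ; 0ℚ; ↥_; ↧_; *≤*)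
import Data.Rational.Properties as ℚP
open import Data.Product using (∃-syntax; _×_; _,_; proj₁; proj₂)
open import Data.Sum using (_⊎_; inj₁; inj₂)
open import Function using (_∘_)
open import Relation.Binary.Definitions using (tri<; tri≈; tri>)
open import Relation.Binary.PropositionalEquality
open import Relation.Nullary using (¬_; yes; no; contradiction)

private
  variable
    A B : Set

Uniform : (A → Set) → (A → Set) → Set
Uniform R P = (∀ x → R x → P x) ⊎ (∀ x → R x → ¬ P x)

uniform-× : {R P Q : A → Set} → Uniform R P → Uniform R Q → Uniform R (λ x → P x × Q x)
uniform-× (inj₁ p) (inj₁ q)  = inj₁ λ x r → p x r , q x r
uniform-× (inj₂ ¬p) _        = inj₂ λ x r pq → ¬p x r (proj₁ pq)
uniform-× (inj₁ _) (inj₂ ¬q) = inj₂ λ x r pq → ¬q x r (proj₂ pq)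

uniform-Π : ∀ {m} {R : A → Set} {P : Fin m → A → Set} →
  (∀ i → Uniform R (P i)) → Uniform R (λ x → ∀ i → P i x)
uniform-Π {m = zero}  _ = inj₁ λ _ _ ()
uniform-Π {m = suc m} u with u Fin.zero | uniform-Π (u ∘ Fin.suc)
... | inj₂ ¬p | _        = inj₂ λ x r ∀p → ¬p x r (∀p Fin.zero)
... | inj₁ _  | inj₂ ¬ps = inj₂ λ x r ∀p → ¬ps x r (∀p ∘ Fin.suc)
... | inj₁ p  | inj₁ ps  = inj₁ λ x r → λ { Fin.zero → p x r ; (Fin.suc i) → ps x r i }

uniform-comap : {R : A → Set} {S P : B → Set} (f : A → B) →
  (∀ x → R x → S (f x)) → Uniform S P → Uniform R (P ∘ f)
uniform-comap f R⇒S (inj₁ p)  = inj₁ λ x r → p (f x) (R⇒S x r)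
uniform-comap f R⇒S (inj₂ ¬p) = inj₂ λ x r → ¬p (f x) (R⇒S x r)

↥-ℤtoℚ : ∀ i → ↥ ℤtoℚ i ≡ i
↥-ℤtoℚ i = begin
  ↥ ℤtoℚ i                   ≡⟨ ℤP.*-identityʳ _ ⟨
  ↥ ℤtoℚ i ℤ.* + 1           ≡⟨ cong (↥ ℤtoℚ i ℤ.*_) (gcd-zeroʳ i) ⟨
  ↥ ℤtoℚ i ℤ.* gcd i (+ 1)   ≡⟨ ℚP.↥-/ i 1 ⟩
  i                          ∎
  where open ≡-Reasoning

↧-ℤtoℚ : ∀ i → ↧ ℤtoℚ i ≡ + 1
↧-ℤtoℚ i = begin
  ↧ ℤtoℚ i                   ≡⟨ ℤP.*-identityʳ _ ⟨
  ↧ ℤtoℚ i ℤ.* + 1           ≡⟨ cong (↧ ℤtoℚ i ℤ.*_) (gcd-zeroʳ i) ⟨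
  ↧ ℤtoℚ i ℤ.* gcd i (+ 1)   ≡⟨ ℚP.↧-/ i 1 ⟩
  + 1                        ∎
  where open ≡-Reasoning

ℤtoℚ-mono-≤ : ∀ {i j} → i ℤ.≤ j → ℤtoℚ i ℚ.≤ ℤtoℚ j
ℤtoℚ-mono-≤ {i} {j} i≤j = *≤* (subst₂ ℤ._≤_
  (sym (cong₂ ℤ._*_ (↥-ℤtoℚ i) (↧-ℤtoℚ j))) (sym (cong₂ ℤ._*_ (↥-ℤtoℚ j) (↧-ℤtoℚ i)))
  (ℤP.*-monoʳ-≤-nonNeg (+ 1) i≤j))

<⇒≱ : ∀ {p q} → p ℚ.< q → ¬ (q ℚ.≤ p)
<⇒≱ p<q q≤p = ℚP.<-irrefl refl (ℚP.<-≤-trans p<q q≤p)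

UnitInterval : ℤ → ℚ → Set
UnitInterval k q = ℤtoℚ k ℚ.< q × q ℚ.< ℤtoℚ (k ℤ.+ + 1)

unitInterval-avoids-ℤ : ∀ k c →
  (∀ q → UnitInterval k q → ℤtoℚ c ℚ.< q) ⊎ (∀ q → UnitInterval k q → q ℚ.< ℤtoℚ c)
unitInterval-avoids-ℤ k c with c ℤP.≤? k
... | yes c≤k = inj₁ λ q k<q<k+1 → ℚP.≤-<-trans (ℤtoℚ-mono-≤ c≤k) (proj₁ k<q<k+1)
... | no  c≰k = inj₂ λ q k<q<k+1 → ℚP.<-≤-trans (proj₂ k<q<k+1) (ℤtoℚ-mono-≤ k+1≤c)
  where
  k+1≤c : k ℤ.+ + 1 ℤ.≤ c
  k+1≤c = subst (ℤ._≤ c) (ℤP.+-comm (+ 1) k) (ℤP.i<j⇒suc[i]≤j (ℤP.≰⇒> c≰k))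

unitInterval-uniform-≥ : ∀ k c → Uniform (UnitInterval k) (ℤtoℚ c ℚ.≤_)
unitInterval-uniform-≥ k c with unitInterval-avoids-ℤ k c
... | inj₁ above = inj₁ λ q q∈k → ℚP.<⇒≤ (above q q∈k)
... | inj₂ below = inj₂ λ q q∈k → <⇒≱ (below q q∈k)

unitInterval-uniform-≤ : ∀ k c → Uniform (UnitInterval k) (ℚ._≤ ℤtoℚ c)
unitInterval-uniform-≤ k c with unitInterval-avoids-ℤ k c
... | inj₁ above = inj₂ λ q q∈k → <⇒≱ (above q q∈k)
... | inj₂ below = inj₁ λ q q∈k → ℚP.<⇒≤ (below q q∈k)

segList-beyond : ∀ {N} (x : Point N) a b (ts : List (Fin N)) →
  All (λ t → b ≤ toℕ t) ts → segList x a b ts ≡ 0ℚ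
segList-beyond x a b []       []           = refl
segList-beyond x a b (t ∷ ts) (b≤t ∷ b≤ts) with a ℕ.≤? toℕ t | toℕ t ℕ.<? b
... | yes _ | yes t<b = contradiction t<b (ℕP.≤⇒≯ b≤t)
... | yes _ | no  _   = segList-beyond x a b ts b≤ts
... | no  _ | _       = segList-beyond x a b ts b≤ts

segList-tabulate-unit : ∀ {N m} (x : Point N) (f : Fin m → Fin N) →
  (∀ {u v} → u Fin.< v → f u Fin.< f v) →
  ∀ j → segList x (toℕ (f j)) (suc (toℕ (f j))) (tabulate f) ≡ x (f j)
segList-tabulate-unit x f f-mono Fin.zero
  with toℕ (f Fin.zero) ℕ.≤? toℕ (f Fin.zero) | toℕ (f Fin.zero) ℕ.<? suc (toℕ (f Fin.zero))
... | yes _ | yes _ = begin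
  x (f Fin.zero) ℚ.+ segList x a (suc a) (tabulate (f ∘ Fin.suc))
    ≡⟨ cong (x (f Fin.zero) ℚ.+_) (segList-beyond x a (suc a) _ (tabulate⁺ λ u → f-mono {Fin.zero} {Fin.suc u} ℕ.z<s)) ⟩
  x (f Fin.zero) ℚ.+ 0ℚ
    ≡⟨ ℚP.+-identityʳ _ ⟩
  x (f Fin.zero) ∎
  where open ≡-Reasoning; a = toℕ (f Fin.zero)
... | yes _ | no a≮1+a = contradiction ℕP.≤-refl a≮1+a
... | no a≰a | _       = contradiction ℕP.≤-refl a≰a
segList-tabulate-unit x f f-mono (Fin.suc j)
  with toℕ (f (Fin.suc j)) ℕ.≤? toℕ (f Fin.zero) | toℕ (f Fin.zero) ℕ.<? suc (toℕ (f (Fin.suc j)))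
... | yes fj≤f0 | _ = contradiction fj≤f0 (ℕP.<⇒≱ (f-mono ℕ.z<s))
... | no  _     | _ = segList-tabulate-unit x (f ∘ Fin.suc) (f-mono ∘ ℕ.s<s) j

seg-unit : ∀ {n} (x : Point n) (t : Fin n) → seg x (toℕ t) (suc (toℕ t)) ≡ x t
seg-unit x = segList-tabulate-unit x (λ t → t) (λ u<v → u<v)

alcove-step : ∀ {n} (k : Fin (suc n) → Fin (suc n) → ℤ) (t : Fin n) →
  ∀ x → inAlcove k x → UnitInterval (k (inject₁ t) (Fin.suc t)) (x t)
alcove-step k t x x∈A =
  subst (UnitInterval (k (inject₁ t) (Fin.suc t))) seg≡xₜ (x∈A (inject₁ t) (Fin.suc t) (FinP.≤̄⇒inject₁< ℕP.≤-refl))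
  where
  seg≡xₜ : seg x (toℕ (inject₁ t)) (suc (toℕ t)) ≡ x t
  seg≡xₜ = trans (cong (λ a → seg x a (suc (toℕ t))) (FinP.toℕ-inject₁ t)) (seg-unit x t)

alcove-span : ∀ {n} (k : Fin (suc n) → Fin (suc n) → ℤ) (u v : Fin (suc n)) → u ≢ v →
  ∃[ l ] (∀ x → inAlcove k x → UnitInterval l (seg x (toℕ u ℕ.⊓ toℕ v) (toℕ u ℕ.⊔ toℕ v)))
alcove-span k u v u≢v with FinP.<-cmp u v
... | tri< u<v _ _ = k u v , λ x x∈A →
  subst₂ (λ a b → UnitInterval (k u v) (seg x a b))
    (sym (ℕP.m≤n⇒m⊓n≡m (ℕP.<⇒≤ u<v))) (sym (ℕP.m≤n⇒m⊔n≡n (ℕP.<⇒≤ u<v))) (x∈A u v u<v)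
... | tri≈ _ u≡v _ = contradiction u≡v u≢v
... | tri> _ _ v<u = k v u , λ x x∈A →
  subst₂ (λ a b → UnitInterval (k v u) (seg x a b))
    (sym (ℕP.m≥n⇒m⊓n≡n (ℕP.<⇒≤ v<u))) (sym (ℕP.m≥n⇒m⊔n≡m (ℕP.<⇒≤ v<u))) (x∈A v u v<u)

permute-adjacent-≢ : ∀ {n} (π : Permutation′ (suc n)) (i : Fin n) →
  π ⟨$⟩ʳ inject₁ i ≢ π ⟨$⟩ʳ Fin.suc i
permute-adjacent-≢ π i πi≡πi+1 = ℕP.1+n≢n (sym (begin
  toℕ i                        ≡⟨ FinP.toℕ-inject₁ i ⟨
  toℕ (inject₁ i)              ≡⟨ cong toℕ (inverseˡ π) ⟨
  toℕ (π ⟨$⟩ˡ (π ⟨$⟩ʳ inject₁ i))  ≡⟨ cong (toℕ ∘ (π ⟨$⟩ˡ_)) πi≡πi+1 ⟩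
  toℕ (π ⟨$⟩ˡ (π ⟨$⟩ʳ Fin.suc i))  ≡⟨ cong toℕ (inverseˡ π) ⟩
  suc (toℕ i)                  ∎))
  where open ≡-Reasoning

lemma5p13 : (n : ℕ) → 1 ≤ n → (π : Permutation′ (suc n)) →
    (k : Fin (suc n) → Fin (suc n) → ℤ) →
    (∀ (x : Point n) → inAlcove k x → inP π x) ⊎
    (∀ (x : Point n) → inAlcove k x → ¬ inP π x)
lemma5p13 n _ π k = uniform-× steps-nonneg spans-in-unit
  where
  steps-nonneg : Uniform (inAlcove k) (λ x → ∀ t → 0ℚ ℚ.≤ x t)
  steps-nonneg = uniform-Π λ t →
    uniform-comap (λ x → x t) (alcove-step k t) (unitInterval-uniform-≥ (k (inject₁ t) (Fin.suc t)) (+ 0))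

  spans-in-unit : Uniform (inAlcove k) (λ x → ∀ i →
    (0ℚ ℚ.≤ seg x (mi π i) (Mi π i)) × (seg x (mi π i) (Mi π i) ℚ.≤ ℤtoℚ (+ 1)))
  spans-in-unit = uniform-Π λ i →
    let (l , x∈A⇒span∈l) = alcove-span k _ _ (permute-adjacent-≢ π i)
    in uniform-comap (λ x → seg x (mi π i) (Mi π i)) x∈A⇒span∈l
         (uniform-× (unitInterval-uniform-≥ l (+ 0)) (unitInterval-uniform-≤ l (+ 1)))
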